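{- Let $\mathit{AP}$ be a finite set of atomic propositions, $\Sigma = 2^{\mathit{AP}}$, $I \subseteq \mathit{AP}$, and let $\varphi \subseteq \Sigma^\omega$ be a linear-time property. Then for every bound $k \in \mathbb{N}$ and every $k' > k$ we have $L_k^I(\varphi) \subseteq L_{k'}^I(\varphi)$.
   Context: For $\sigma \in \Sigma^\omega$, $\sigma|_I \in (2^I)^\omega$ denotes its projection onto $I$ (letterwise intersection with $I$). A word $\sigma \in \Sigma^\omega$ is an $I$-$k$-model of $\varphi$ if $\sigma \in \varphi$ and there exist finite words $u \in (2^I)^*$ and $v \in (2^I)^+$ with $|u\cdot v| = k$ and $\sigma|_I = u \cdot v^\omega$ (i.e. the input part of $\sigma$ is given by a lasso of length $k$). $L_k^I(\varphi)$ denotes the set of all $I$-$k$-models of $\varphi$. -}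

module Defs where

open import Data.Nat using (ℕ; zero; suc; _+_)
open import Data.Nat.DivMod using (_mod_)
open import Data.Fin using (Fin)
open import Data.Fin.Subset as S using (Subset; _∩_)
open import Data.List using (List; []; _∷_; length; lookup)
open import Data.List.NonEmpty as L⁺ using (List⁺; _∷_; toList)
open import Data.List.Relation.Unary.All using (All)
open import Data.Product using (Σ-syntax; _×_)
open import Relation.Binary.PropositionalEquality using (_≡_)
open import Relation.Unary using (Pred)
open import Level using (0ℓ)

-- Atomic propositions AP = Fin n; letters Σ = 2^AP = Subset n.
-- ω-words over Σ are functions ℕ → Σ.
Word : ℕ → Set
Word n = ℕ → Subset n

LTProp : ℕ → Set₁
LTProp n = Pred (Word n) 0ℓ

proj : ∀ {n} → Subset n → Word n → Word n
proj I σ i = σ i ∩ I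

omega : ∀ {A : Set} → List⁺ A → ℕ → A
omega (x ∷ xs) i = lookup (x ∷ xs) (i mod suc (length xs))

lasso : ∀ {A : Set} → List A → List⁺ A → ℕ → A
lasso []       v i       = omega v i
lasso (x ∷ u)  v zero    = x
lasso (x ∷ u)  v (suc i) = lasso u v i

WordOver : ∀ {n} → Subset n → List (Subset n) → Set
WordOver I w = All (S._⊆ I) w

IkModel : ∀ {n} → Subset n → ℕ → LTProp n → Word n → Set
IkModel I k φ σ =
  φ σ ×
  Σ[ u ∈ List (Subset _) ] Σ[ v ∈ List⁺ (Subset _) ]
    (WordOver I u × WordOver I (toList v) ×
     (length u + L⁺.length v ≡ k) ×
     (∀ i → proj I σ i ≡ lasso u v i))

L : ∀ {n} → ℕ → Subset n → LTProp n → Pred (Word n) 0ℓ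
L k I φ = IkModel I k φ

-- Shifting the period of a lasso: since (x · w)^ω = x · (w · x)^ω, the word
-- u · (x · w)^ω equals (u · x) · (w · x)^ω, a lasso one letter longer over the
-- same letters. The identity holds because both sides are fixed points of
-- X ↦ x · w · X, and prefixing a nonempty word has a unique fixed point.
module Submission where

open import Defs
open import Data.Nat using (ℕ; zero; suc; _+_; _∸_; _%_; _<_; _≤_; _≤′_; ≤′-refl; ≤′-step; _<?_; s≤s)
open import Data.Nat.Properties
  using (≤-refl; ≤-trans; m≤n+m; m∸n+n≡m; m+[n∸m]≡n; ≮⇒≥; +-comm; <⇒≤; ≤⇒≤′)
open import Data.Nat.DivMod using (_mod_; m<n⇒m%n≡m; [m+n]%n≡m%n)
open import Data.Fin using (Fin; toℕ; fromℕ<)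
open import Data.Fin.Properties using (toℕ-fromℕ<; toℕ-injective)
open import Data.Fin.Subset using (Subset)
open import Data.List using (List; []; _∷_; [_]; _++_; _∷ʳ_; length; lookup)
open import Data.List.Properties using (length-++)
open import Data.List.NonEmpty as List⁺ using (List⁺; _∷_; toList)
open import Data.List.Relation.Unary.All using (_∷_)
open import Data.List.Relation.Unary.All.Properties using (∷ʳ⁺)
open import Data.Product using (_,_)
open import Function using (id; _∘_)
open import Relation.Binary.PropositionalEquality
  using (_≡_; _≗_; refl; sym; trans; cong; cong₂; subst; module ≡-Reasoning)
open import Relation.Nullary using (yes; no)
open import Relation.Unary using (_⊆_)

private
  variable
    A : Set

prepend : List A → (ℕ → A) → ℕ → A
prepend []      s i       = s i
prepend (x ∷ w) s zero    = x
prepend (x ∷ w) s (suc i) = prepend w s i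

prepend-cong : ∀ (w : List A) {s t} → s ≗ t → prepend w s ≗ prepend w t
prepend-cong []      s≗t i       = s≗t i
prepend-cong (x ∷ w) s≗t zero    = refl
prepend-cong (x ∷ w) s≗t (suc i) = prepend-cong w s≗t i

prepend-++ : ∀ (u w : List A) s → prepend (u ++ w) s ≗ prepend u (prepend w s)
prepend-++ []      w s i       = refl
prepend-++ (x ∷ u) w s zero    = refl
prepend-++ (x ∷ u) w s (suc i) = prepend-++ u w s i

prepend-lookup : ∀ (w : List A) s {i} (i<∣w∣ : i < length w) →
                 prepend w s i ≡ lookup w (fromℕ< i<∣w∣)
prepend-lookup (x ∷ w) s {zero}  _             = refl
prepend-lookup (x ∷ w) s {suc i} (s≤s i<∣w∣) = prepend-lookup w s i<∣w∣

prepend-drop : ∀ (w : List A) s i → prepend w s (length w + i) ≡ s i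
prepend-drop []      s i = refl
prepend-drop (x ∷ w) s i = prepend-drop w s i

prepend-agree-below : ∀ (w : List A) {s t} n → (∀ j → j < n → s j ≡ t j) →
                      ∀ i → i < length w + n → prepend w s i ≡ prepend w t i
prepend-agree-below []      n s≈t i       i<n      = s≈t i i<n
prepend-agree-below (x ∷ w) n s≈t zero    _        = refl
prepend-agree-below (x ∷ w) n s≈t (suc i) (s≤s i<) = prepend-agree-below w n s≈t i i<

-- Each round of unfolding s = x · w · s fixes one more position.
prepend-fixpoint-unique : ∀ (x : A) w {s t} →
  s ≗ prepend (x ∷ w) s → t ≗ prepend (x ∷ w) t → s ≗ t
prepend-fixpoint-unique x w {s} {t} s-fix t-fix i = agree (suc i) i ≤-refl
  where
  agree : ∀ n j → j < n → s j ≡ t j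
  agree zero    j ()
  agree (suc n) j j<1+n = begin
    s j                     ≡⟨ s-fix j ⟩
    prepend (x ∷ w) s j     ≡⟨ prepend-agree-below (x ∷ w) n (agree n) j j<∣xw∣+n ⟩
    prepend (x ∷ w) t j     ≡⟨ sym (t-fix j) ⟩
    t j                     ∎
    where
    open ≡-Reasoning
    j<∣xw∣+n : j < suc (length w) + n
    j<∣xw∣+n = ≤-trans j<1+n (s≤s (m≤n+m n (length w)))

omega-lookup : ∀ (x : A) xs i (j : Fin (suc (length xs))) →
               i % suc (length xs) ≡ toℕ j → omega (x ∷ xs) i ≡ lookup (x ∷ xs) j
omega-lookup x xs i j i%p≡j = cong (lookup (x ∷ xs)) (toℕ-injective (trans (toℕ-fromℕ< _) i%p≡j))

omega-periodic : ∀ (v : List⁺ A) i → omega v (i + List⁺.length v) ≡ omega v i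
omega-periodic (x ∷ xs) i =
  omega-lookup x xs (i + suc (length xs)) (i mod suc (length xs))
    (trans ([m+n]%n≡m%n i (suc (length xs))) (sym (toℕ-fromℕ< _)))

omega-unfold : ∀ (v : List⁺ A) → omega v ≗ prepend (toList v) (omega v)
omega-unfold v@(x ∷ xs) i with i <? List⁺.length v
... | yes i<p = begin
  omega v i                              ≡⟨ omega-lookup x xs i (fromℕ< i<p) i%p≡i ⟩
  lookup (x ∷ xs) (fromℕ< i<p)           ≡⟨ sym (prepend-lookup (x ∷ xs) (omega v) i<p) ⟩
  prepend (toList v) (omega v) i         ∎
  where
  open ≡-Reasoning
  i%p≡i : i % suc (length xs) ≡ toℕ (fromℕ< i<p)
  i%p≡i = trans (m<n⇒m%n≡m i<p) (sym (toℕ-fromℕ< i<p))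
... | no i≮p = begin
  omega v i                              ≡⟨ cong (omega v) (sym (m∸n+n≡m p≤i)) ⟩
  omega v (i ∸ p + p)                    ≡⟨ omega-periodic v (i ∸ p) ⟩
  omega v (i ∸ p)                        ≡⟨ sym (prepend-drop (toList v) (omega v) (i ∸ p)) ⟩
  prepend (toList v) (omega v) (p + (i ∸ p)) ≡⟨ cong (prepend (toList v) (omega v)) (m+[n∸m]≡n p≤i) ⟩
  prepend (toList v) (omega v) i         ∎
  where
  open ≡-Reasoning
  p = List⁺.length v
  p≤i : p ≤ i
  p≤i = ≮⇒≥ i≮p

toList-∷ʳ : ∀ (xs : List A) x → toList (xs List⁺.∷ʳ x) ≡ xs ∷ʳ x
toList-∷ʳ []       x = refl
toList-∷ʳ (y ∷ xs) x = refl

omega-rotate : ∀ (x : A) xs → omega (x ∷ xs) ≗ prepend [ x ] (omega (xs List⁺.∷ʳ x))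
omega-rotate x xs = prepend-fixpoint-unique x xs (omega-unfold (x ∷ xs)) rotated-fix
  where
  rotated : List⁺ _
  rotated = xs List⁺.∷ʳ x

  rotated-fix : prepend [ x ] (omega rotated) ≗ prepend (x ∷ xs) (prepend [ x ] (omega rotated))
  rotated-fix i = begin
    prepend [ x ] (omega rotated) i
      ≡⟨ prepend-cong [ x ] (omega-unfold rotated) i ⟩
    prepend [ x ] (prepend (toList rotated) (omega rotated)) i
      ≡⟨ cong (λ w → prepend [ x ] (prepend w (omega rotated)) i) (toList-∷ʳ xs x) ⟩
    prepend [ x ] (prepend (xs ++ [ x ]) (omega rotated)) i
      ≡⟨ prepend-cong [ x ] (prepend-++ xs [ x ] (omega rotated)) i ⟩
    prepend [ x ] (prepend xs (prepend [ x ] (omega rotated))) i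
      ≡⟨ sym (prepend-++ [ x ] xs (prepend [ x ] (omega rotated)) i) ⟩
    prepend (x ∷ xs) (prepend [ x ] (omega rotated)) i ∎
    where open ≡-Reasoning

lasso≗prepend : ∀ (u : List A) v → lasso u v ≗ prepend u (omega v)
lasso≗prepend []      v i       = refl
lasso≗prepend (x ∷ u) v zero    = refl
lasso≗prepend (x ∷ u) v (suc i) = lasso≗prepend u v i

lasso-∷ʳ : ∀ (u : List A) x xs → lasso u (x ∷ xs) ≗ lasso (u ∷ʳ x) (xs List⁺.∷ʳ x)
lasso-∷ʳ u x xs i = begin
  lasso u (x ∷ xs) i                                     ≡⟨ lasso≗prepend u (x ∷ xs) i ⟩
  prepend u (omega (x ∷ xs)) i                           ≡⟨ prepend-cong u (omega-rotate x xs) i ⟩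
  prepend u (prepend [ x ] (omega (xs List⁺.∷ʳ x))) i     ≡⟨ sym (prepend-++ u [ x ] _ i) ⟩
  prepend (u ∷ʳ x) (omega (xs List⁺.∷ʳ x)) i             ≡⟨ sym (lasso≗prepend (u ∷ʳ x) _ i) ⟩
  lasso (u ∷ʳ x) (xs List⁺.∷ʳ x) i                       ∎
  where open ≡-Reasoning

length-∷ʳ : ∀ (xs : List A) x → length (xs ∷ʳ x) ≡ suc (length xs)
length-∷ʳ xs x = trans (length-++ xs) (+-comm (length xs) 1)

length⁺-∷ʳ : ∀ (xs : List A) x → List⁺.length (xs List⁺.∷ʳ x) ≡ suc (length xs)
length⁺-∷ʳ xs x = trans (cong length (toList-∷ʳ xs x)) (length-∷ʳ xs x)

L-step : ∀ {n} k (I : Subset n) φ → L k I φ ⊆ L (suc k) I φ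
L-step k I φ (φσ , u , x ∷ xs , u⊆I , x⊆I ∷ xs⊆I , |u|+|v|≡k , σ|I≗uv^ω) =
  φσ , u ∷ʳ x , xs List⁺.∷ʳ x , ∷ʳ⁺ u⊆I x⊆I , rotated⊆I , |u′|+|v′|≡1+k ,
  λ i → trans (σ|I≗uv^ω i) (lasso-∷ʳ u x xs i)
  where
  rotated⊆I : WordOver I (toList (xs List⁺.∷ʳ x))
  rotated⊆I = subst (WordOver I) (sym (toList-∷ʳ xs x)) (∷ʳ⁺ xs⊆I x⊆I)

  |u′|+|v′|≡1+k : length (u ∷ʳ x) + List⁺.length (xs List⁺.∷ʳ x) ≡ suc k
  |u′|+|v′|≡1+k = trans (cong₂ _+_ (length-∷ʳ u x) (length⁺-∷ʳ xs x)) (cong suc |u|+|v|≡k)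

L-mono : ∀ {n} {k k′} (I : Subset n) φ → k ≤′ k′ → L k I φ ⊆ L k′ I φ
L-mono I φ ≤′-refl            = id
L-mono I φ (≤′-step {k′} k≤k′) = L-step k′ I φ ∘ L-mono I φ k≤k′

lemma1 : (n : ℕ) (I : Subset n) (φ : LTProp n) (k k′ : ℕ) →
    k < k′ → L k I φ ⊆ L k′ I φ
lemma1 n I φ k k′ k<k′ = L-mono I φ (≤⇒≤′ (<⇒≤ k<k′))
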